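{- Let $(a_j)_{j\ge1}$ be nonnegative integers with $a_1=1$, and let $F_n(z)=[q^n]\prod_{j=1}^{\infty}(1-zq^j)^{ -a_j}$. Then for all $n\ge0$ and all $k\ge n/2$, $[z^k]F_n(z)=[z^{k+1}]F_{n+1}(z)$.
   Context: $[q^n]$ and $[z^k]$ denote coefficient extraction. -}

module Defs where

open import Data.Nat using (ℕ; zero; suc; _+_; _*_; _∸_)
open import Data.Nat.Properties using (_≟_)
open import Data.Bool using (if_then_else_)
open import Relation.Nullary.Decidable using (⌊_⌋)

-- Formal power series in q with polynomial coefficients in z and
-- coefficients in ℕ:  S n k  =  [q^n z^k] S.
Series : Set
Series = ℕ → ℕ → ℕ

sumTo : ℕ → (ℕ → ℕ) → ℕ
sumTo zero    f = f zero
sumTo (suc n) f = sumTo n f + f (suc n)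

one : Series
one zero zero = 1
one _    _    = 0

_⊛_ : Series → Series → Series
(f ⊛ g) n k = sumTo n (λ i → sumTo k (λ l → f i l * g (n ∸ i) (k ∸ l)))

pow : Series → ℕ → Series
pow S zero    = one
pow S (suc a) = S ⊛ pow S a

-- (1 - z q^j)^{-1} = Σ_m z^m q^{j m}
geom : ℕ → Series
geom j n k = if ⌊ n ≟ j * k ⌋ then 1 else 0

factor : ℕ → ℕ → Series
factor j a = pow (geom j) a

partialProd : (ℕ → ℕ) → ℕ → Series
partialProd a zero    = one
partialProd a (suc N) = partialProd a N ⊛ factor (suc N) (a (suc N))

-- Factors with j > n are 1 + O(q^{n+1}), so the q^n coefficient of the
-- infinite product equals that of the finite product over j ≤ n.
-- Hence  [z^k] F_n(z) = coeffF a n k.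
coeffF : (ℕ → ℕ) → ℕ → ℕ → ℕ
coeffF a n k = partialProd a n n k

-- Write P_N = ∏_{j ≤ N} (1 - z q^j)^{-a_j}. For N ≥ 1 the coefficients satisfy
-- [q^{n+1} z^{k+1}] P_N = [q^n z^k] P_N whenever n ≤ 2k: for N = 1 this is the
-- shift invariance of (1 - z q)^{-1}, and every further factor with j ≥ 2 only
-- contains monomials z^l q^m with m ≥ 2l, which lets the invariance pass through
-- the Cauchy product.  Since the factors with j > n do not affect [q^n], the
-- coefficient [q^n z^k] F equals [q^n z^k] P_n, and the corollary follows.
module Submission where

open import Defs
open import Data.Nat using (ℕ; zero; suc; _+_; _*_; _∸_; _≤_; _<_; z≤n; s≤s; _≤?_)
open import Data.Nat.Properties
open import Data.Empty using (⊥-elim)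
open import Relation.Binary.PropositionalEquality
  using (_≡_; _≢_; refl; sym; trans; cong; cong₂; subst; module ≡-Reasoning)
open import Relation.Nullary using (yes; no)

sumTo-cong : ∀ n {f g : ℕ → ℕ} → (∀ i → i ≤ n → f i ≡ g i) → sumTo n f ≡ sumTo n g
sumTo-cong zero    f≗g = f≗g zero z≤n
sumTo-cong (suc n) f≗g =
  cong₂ _+_ (sumTo-cong n (λ i i≤n → f≗g i (m≤n⇒m≤1+n i≤n))) (f≗g (suc n) ≤-refl)

sumTo-zero : ∀ n {f : ℕ → ℕ} → (∀ i → i ≤ n → f i ≡ 0) → sumTo n f ≡ 0
sumTo-zero zero    f≗0 = f≗0 zero z≤n
sumTo-zero (suc n) f≗0 =
  cong₂ _+_ (sumTo-zero n (λ i i≤n → f≗0 i (m≤n⇒m≤1+n i≤n))) (f≗0 (suc n) ≤-refl)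

sumTo-suc : ∀ n (f : ℕ → ℕ) → sumTo (suc n) f ≡ f 0 + sumTo n (λ i → f (suc i))
sumTo-suc zero    f = refl
sumTo-suc (suc n) f = trans (cong (_+ f (suc (suc n))) (sumTo-suc n f)) (+-assoc (f 0) _ _)

sumTo-last : ∀ n (f : ℕ → ℕ) → (∀ i → i < n → f i ≡ 0) → sumTo n f ≡ f n
sumTo-last zero    f f≗0 = refl
sumTo-last (suc n) f f≗0 = cong (_+ f (suc n)) (sumTo-zero n (λ i i≤n → f≗0 i (s≤s i≤n)))

sumTo-first : ∀ n (f : ℕ → ℕ) → (∀ i → i < n → f (suc i) ≡ 0) → sumTo n f ≡ f 0
sumTo-first zero    f f≗0 = refl
sumTo-first (suc n) f f≗0 = begin
  sumTo (suc n) f                     ≡⟨ sumTo-suc n f ⟩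
  f 0 + sumTo n (λ i → f (suc i))     ≡⟨ cong (f 0 +_) (sumTo-zero n (λ i i≤n → f≗0 i (s≤s i≤n))) ⟩
  f 0 + 0                             ≡⟨ +-identityʳ (f 0) ⟩
  f 0                                 ∎
  where open ≡-Reasoning

one-sucʳ : ∀ m l → one m (suc l) ≡ 0
one-sucʳ zero    l = refl
one-sucʳ (suc m) l = refl

one-≢0ˡ : ∀ {m} l → m ≢ 0 → one m l ≡ 0
one-≢0ˡ {zero}  l m≢0 = ⊥-elim (m≢0 refl)
one-≢0ˡ {suc m} l m≢0 = refl

one-≢0ʳ : ∀ m {l} → l ≢ 0 → one m l ≡ 0
one-≢0ʳ m {zero}  l≢0 = ⊥-elim (l≢0 refl)
one-≢0ʳ m {suc l} l≢0 = one-sucʳ m l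

⊛-identityʳ : ∀ f n k → (f ⊛ one) n k ≡ f n k
⊛-identityʳ f n k = begin
  (f ⊛ one) n k                               ≡⟨ sumTo-last n _ (λ i i<n → sumTo-zero k (λ l _ →
                                                   *-zeroʳ-by (f i l) (one-≢0ˡ (k ∸ l) (m>n⇒m∸n≢0 i<n)))) ⟩
  sumTo k (λ l → f n l * one (n ∸ n) (k ∸ l)) ≡⟨ sumTo-last k _ (λ l l<k →
                                                   *-zeroʳ-by (f n l) (one-≢0ʳ (n ∸ n) (m>n⇒m∸n≢0 l<k))) ⟩
  f n k * one (n ∸ n) (k ∸ k)                 ≡⟨ cong₂ (λ i l → f n k * one i l) (n∸n≡0 n) (n∸n≡0 k) ⟩
  f n k * 1                                   ≡⟨ *-identityʳ (f n k) ⟩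
  f n k                                       ∎
  where
  open ≡-Reasoning
  *-zeroʳ-by : ∀ x {y} → y ≡ 0 → x * y ≡ 0
  *-zeroʳ-by x refl = *-zeroʳ x

⊛-identityˡ : ∀ f n k → (one ⊛ f) n k ≡ f n k
⊛-identityˡ f n k = begin
  (one ⊛ f) n k                             ≡⟨ sumTo-first n _ (λ i _ → sumTo-zero k (λ l _ → refl)) ⟩
  sumTo k (λ l → one 0 l * f (n ∸ 0) (k ∸ l)) ≡⟨ sumTo-first k _ (λ l _ →
                                                 cong (_* f n (k ∸ suc l)) (one-sucʳ 0 l)) ⟩
  f n k + 0                                 ≡⟨ +-identityʳ (f n k) ⟩
  f n k                                     ∎
  where open ≡-Reasoning

geom-≡ : ∀ j {m l} → m ≡ j * l → geom j m l ≡ 1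
geom-≡ j {m} {l} m≡jl with m ≟ j * l
... | yes _    = refl
... | no m≢jl = ⊥-elim (m≢jl m≡jl)

geom-≢ : ∀ j {m l} → m ≢ j * l → geom j m l ≡ 0
geom-≢ j {m} {l} m≢jl with m ≟ j * l
... | yes m≡jl = ⊥-elim (m≢jl m≡jl)
... | no _     = refl

geom-one-shift : ∀ n k → geom 1 (suc n) (suc k) ≡ geom 1 n k
geom-one-shift n k with n ≟ k
... | yes refl = trans (geom-≡ 1 (sym (*-identityˡ (suc n)))) (sym (geom-≡ 1 (sym (*-identityˡ n))))
... | no  n≢k  = trans (geom-≢ 1 (λ eq → n≢k (suc-injective (trans eq (*-identityˡ (suc k))))))
                       (sym (geom-≢ 1 (λ eq → n≢k (trans eq (*-identityˡ k)))))

OneBelow : ℕ → Series → Set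
OneBelow M g = ∀ m l → m < M → g m l ≡ one m l

⊛-identity-below : ∀ {M} f g → OneBelow M g → ∀ n k → n < M → (f ⊛ g) n k ≡ f n k
⊛-identity-below f g g≈1 n k n<M = trans
  (sumTo-cong n (λ i _ → sumTo-cong k (λ l _ →
     cong (f i l *_) (g≈1 (n ∸ i) (k ∸ l) (≤-<-trans (m∸n≤m n i) n<M)))))
  (⊛-identityʳ f n k)

oneBelow-⊛ : ∀ {M} f g → OneBelow M f → OneBelow M g → OneBelow M (f ⊛ g)
oneBelow-⊛ f g f≈1 g≈1 m l m<M = trans (⊛-identity-below f g g≈1 m l m<M) (f≈1 m l m<M)

oneBelow-pow : ∀ {M} S → OneBelow M S → ∀ a → OneBelow M (pow S a)
oneBelow-pow S S≈1 zero    m l _ = refl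
oneBelow-pow S S≈1 (suc a) = oneBelow-⊛ S (pow S a) S≈1 (oneBelow-pow S S≈1 a)

oneBelow-geom : ∀ j → OneBelow j (geom j)
oneBelow-geom j zero    zero    _   = geom-≡ j (sym (*-zeroʳ j))
oneBelow-geom j (suc m) zero    _   = geom-≢ j (λ eq → 1+n≢0 (trans eq (*-zeroʳ j)))
oneBelow-geom j m       (suc l) m<j =
  trans (geom-≢ j (λ eq → <⇒≱ m<j (subst (j ≤_) (sym eq) (m≤m*n j (suc l))))) (sym (one-sucʳ m l))

oneBelow-mono : ∀ {M M′} g → M′ ≤ M → OneBelow M g → OneBelow M′ g
oneBelow-mono g M′≤M g≈1 m l m<M′ = g≈1 m l (<-≤-trans m<M′ M′≤M)

oneBelow-factor : ∀ j a → OneBelow j (factor j a)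
oneBelow-factor j = oneBelow-pow (geom j) (oneBelow-geom j)

partialProd-oneBelow : ∀ a N → OneBelow 1 (partialProd a N)
partialProd-oneBelow a zero    m l _ = refl
partialProd-oneBelow a (suc N) =
  oneBelow-⊛ _ _ (partialProd-oneBelow a N)
    (oneBelow-mono _ (s≤s z≤n) (oneBelow-factor (suc N) (a (suc N))))

Supported≥2 : Series → Set
Supported≥2 g = ∀ m l → m < 2 * l → g m l ≡ 0

double-∸ : ∀ l l′ → 2 * l ∸ 2 * l′ ≡ 2 * (l ∸ l′)
double-∸ l l′ = sym (*-distribˡ-∸ 2 l l′)

∸-<-below : ∀ {i m} l′ l → i ≤ m → m < 2 * l → 2 * l′ ≤ i → m ∸ i < 2 * (l ∸ l′)
∸-<-below {i} {m} l′ l i≤m m<2l 2l′≤i = begin-strict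
  m ∸ i           ≤⟨ ∸-monoʳ-≤ m 2l′≤i ⟩
  m ∸ 2 * l′      <⟨ ∸-monoˡ-< m<2l (≤-trans 2l′≤i i≤m) ⟩
  2 * l ∸ 2 * l′  ≡⟨ double-∸ l l′ ⟩
  2 * (l ∸ l′)    ∎
  where open ≤-Reasoning

∸-<-above : ∀ {i n} l k → i ≤ n → n ≤ 2 * k → 2 * l < i → n ∸ i < 2 * (k ∸ l)
∸-<-above {i} {n} l k i≤n n≤2k 2l<i = begin-strict
  n ∸ i           <⟨ ∸-monoʳ-< 2l<i i≤n ⟩
  n ∸ 2 * l       ≤⟨ ∸-monoˡ-≤ (2 * l) n≤2k ⟩
  2 * k ∸ 2 * l   ≡⟨ double-∸ k l ⟩
  2 * (k ∸ l)     ∎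
  where open ≤-Reasoning

supported≥2-⊛ : ∀ f g → Supported≥2 f → Supported≥2 g → Supported≥2 (f ⊛ g)
supported≥2-⊛ f g f≥2 g≥2 m l m<2l =
  sumTo-zero m (λ i i≤m → sumTo-zero l (λ l′ _ → term i l′ i≤m))
  where
  term : ∀ i l′ → i ≤ m → f i l′ * g (m ∸ i) (l ∸ l′) ≡ 0
  term i l′ i≤m with 2 * l′ ≤? i
  ... | no  2l′≰i = cong (_* g (m ∸ i) (l ∸ l′)) (f≥2 i l′ (≰⇒> 2l′≰i))
  ... | yes 2l′≤i = trans (cong (f i l′ *_) (g≥2 _ _ (∸-<-below l′ l i≤m m<2l 2l′≤i))) (*-zeroʳ (f i l′))

supported≥2-pow : ∀ S → Supported≥2 S → ∀ a → Supported≥2 (pow S a)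
supported≥2-pow S S≥2 zero    m zero    ()
supported≥2-pow S S≥2 zero    m (suc l) _ = one-sucʳ m l
supported≥2-pow S S≥2 (suc a) = supported≥2-⊛ S (pow S a) S≥2 (supported≥2-pow S S≥2 a)

supported≥2-geom : ∀ j → 2 ≤ j → Supported≥2 (geom j)
supported≥2-geom j 2≤j m l m<2l = geom-≢ j (λ eq → <⇒≱ m<2l (subst (2 * l ≤_) (sym eq) (*-monoˡ-≤ l 2≤j)))

DiagonalShiftInvariant : Series → Set
DiagonalShiftInvariant P = ∀ n k → n ≤ 2 * k → P (suc n) (suc k) ≡ P n k

-- Peeling off the row i = 0 and the column l = 0 of the double sum for
-- (P ⊛ g) (n+1) (k+1) leaves, term by term, P (i+1) (l+1) * g (n-i) (k-l); where
-- i > 2l the support of g kills both this term and its unshifted counterpart.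
⊛-diagonalShiftInvariant : ∀ P g → (∀ l → P 0 (suc l) ≡ 0) → Supported≥2 g →
  DiagonalShiftInvariant P → DiagonalShiftInvariant (P ⊛ g)
⊛-diagonalShiftInvariant P g P₀≡0 g≥2 P-inv n k n≤2k = begin
  (P ⊛ g) (suc n) (suc k)
    ≡⟨ sumTo-suc n _ ⟩
  row₀ + sumTo n (λ i → sumTo (suc k) (λ l → P (suc i) l * g (n ∸ i) (suc k ∸ l)))
    ≡⟨ cong₂ _+_ row₀≡0 (sumTo-cong n (λ i _ → sumTo-suc k _)) ⟩
  sumTo n (λ i → P (suc i) 0 * g (n ∸ i) (suc k)
                 + sumTo k (λ l → P (suc i) (suc l) * g (n ∸ i) (k ∸ l)))
    ≡⟨ sumTo-cong n (λ i i≤n → cong₂ _+_ (column₀≡0 i i≤n)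
                                         (sumTo-cong k (λ l _ → interior i l i≤n))) ⟩
  (P ⊛ g) n k
    ∎
  where
  open ≡-Reasoning
  row₀ : ℕ
  row₀ = sumTo (suc k) (λ l → P 0 l * g (suc n) (suc k ∸ l))

  n<2+2k : n < 2 * suc k
  n<2+2k = ≤-<-trans n≤2k (*-monoʳ-< 2 (n<1+n k))

  row₀≡0 : row₀ ≡ 0
  row₀≡0 = sumTo-zero (suc k) entry
    where
    entry : ∀ l → l ≤ suc k → P 0 l * g (suc n) (suc k ∸ l) ≡ 0
    entry zero    _ = trans (cong (P 0 0 *_) (g≥2 _ _ 1+n<2+2k)) (*-zeroʳ (P 0 0))
      where
      1+n<2+2k : suc n < 2 * suc k
      1+n<2+2k = subst (suc n <_) (sym (*-distribˡ-+ 2 1 k)) (s≤s (s≤s n≤2k))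
    entry (suc l) _ = cong (_* g (suc n) (k ∸ l)) (P₀≡0 l)

  column₀≡0 : ∀ i → i ≤ n → P (suc i) 0 * g (n ∸ i) (suc k) ≡ 0
  column₀≡0 i i≤n =
    trans (cong (P (suc i) 0 *_) (g≥2 _ _ (≤-<-trans (m∸n≤m n i) n<2+2k))) (*-zeroʳ (P (suc i) 0))

  interior : ∀ i l → i ≤ n →
    P (suc i) (suc l) * g (n ∸ i) (k ∸ l) ≡ P i l * g (n ∸ i) (k ∸ l)
  interior i l i≤n with i ≤? 2 * l
  ... | yes i≤2l = cong (_* g (n ∸ i) (k ∸ l)) (P-inv i l i≤2l)
  ... | no  i≰2l = begin
    P (suc i) (suc l) * g (n ∸ i) (k ∸ l) ≡⟨ cong (P (suc i) (suc l) *_) g≡0 ⟩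
    P (suc i) (suc l) * 0                 ≡⟨ *-zeroʳ (P (suc i) (suc l)) ⟩
    0                                     ≡⟨ sym (*-zeroʳ (P i l)) ⟩
    P i l * 0                             ≡⟨ cong (P i l *_) (sym g≡0) ⟩
    P i l * g (n ∸ i) (k ∸ l)             ∎
    where
    g≡0 : g (n ∸ i) (k ∸ l) ≡ 0
    g≡0 = g≥2 _ _ (∸-<-above l k i≤n n≤2k (≰⇒> i≰2l))

partialProd-one : ∀ a → a 1 ≡ 1 → ∀ n k → partialProd a 1 n k ≡ geom 1 n k
partialProd-one a a₁≡1 n k rewrite a₁≡1 =
  trans (⊛-identityˡ (geom 1 ⊛ one) n k) (⊛-identityʳ (geom 1) n k)

partialProd-diagonalShiftInvariant : ∀ a → a 1 ≡ 1 → ∀ N →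
  DiagonalShiftInvariant (partialProd a (suc N))
partialProd-diagonalShiftInvariant a a₁≡1 zero n k _ =
  trans (partialProd-one a a₁≡1 (suc n) (suc k))
    (trans (geom-one-shift n k) (sym (partialProd-one a a₁≡1 n k)))
partialProd-diagonalShiftInvariant a a₁≡1 (suc N) =
  ⊛-diagonalShiftInvariant (partialProd a (suc N)) _
    (λ l → partialProd-oneBelow a (suc N) 0 (suc l) (s≤s z≤n))
    (supported≥2-pow _ (supported≥2-geom (suc (suc N)) (s≤s (s≤s z≤n))) (a (suc (suc N))))
    (partialProd-diagonalShiftInvariant a a₁≡1 N)

corollary1 : (a : ℕ → ℕ) → a 1 ≡ 1 →
    (n k : ℕ) → n ≤ 2 * k → coeffF a n k ≡ coeffF a (suc n) (suc k)
corollary1 a a₁≡1 n k n≤2k = sym (begin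
  partialProd a (suc n) (suc n) (suc k) ≡⟨ partialProd-diagonalShiftInvariant a a₁≡1 n n k n≤2k ⟩
  partialProd a (suc n) n k             ≡⟨ ⊛-identity-below (partialProd a n) _
                                             (oneBelow-factor (suc n) (a (suc n))) n k ≤-refl ⟩
  partialProd a n n k                   ∎)
  where open ≡-Reasoning
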